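{- For every $X \in \mathbf{term}$, $\mathsf{enc}\,X$ is a $\beta$-normal form in $\mathbf{term}'$: for all $Y \in \mathbf{term}'$, if $\mathsf{enc}\,X \twoheadrightarrow Y$ then $Y = \mathsf{enc}\,X$.
   Context: Let $\mathbf{var}$ be an infinite type of variables and $\mathbf{const}$ a type of constants. $\mathbf{term}$ is the type of $\lambda$-terms with constants from $\mathbf{const}$, built from $\mathsf{Var}\,x$, $\mathsf{Ct}\,c$, $\mathsf{App}\,X\,Y$, $\mathsf{Lm}\,x\,X$, identified up to $\alpha$-equivalence ($\mathsf{Lm}\,x\,X$ binds $x$ in $X$). $\mathbf{term}'$ is the analogous type with constants from $\mathbf{const}\cup\{\mathsf{ctapp},\mathsf{ctlm}\}$ ($\mathsf{ctapp},\mathsf{ctlm}$ two new distinct constants; $\mathsf{ctapp}$, $\mathsf{ctlm}$ also denote the terms $\mathsf{Ct}\,\mathsf{ctapp}$, $\mathsf{Ct}\,\mathsf{ctlm}$). $X[Y/y]$ is capture-avoiding substitution. A partial function $\mathsf{Ctapp}$ from pairs of constants in $\mathbf{const}$ to terms is fixed; on $\mathbf{term}'$ it is used via the inclusion $\mathbf{const}\subseteq\mathbf{const}\cup\{\mathsf{ctapp},\mathsf{ctlm}\}$ (hence $\mathbf{term}\subseteq\mathbf{term}'$) and is undefined whenever an argument is $\mathsf{ctapp}$ or $\mathsf{ctlm}$. The one-step reduction $\to$ on $\mathbf{term}'$ is the least relation closed under ($\beta$) $\mathsf{App}\,(\mathsf{Lm}\,y\,X)\,Y\to X[Y/y]$;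 ($\delta$) $\mathsf{Ctapp}\,c_1\,c_2=\mathsf{Some}\,X$ implies $\mathsf{App}\,(\mathsf{Ct}\,c_1)\,(\mathsf{Ct}\,c_2)\to X$; (AppL) $X\to X'$ implies $\mathsf{App}\,X\,Y\to\mathsf{App}\,X'\,Y$; (AppR) $Y\to Y'$ implies $\mathsf{App}\,X\,Y\to\mathsf{App}\,X\,Y'$; ($\xi$) $X\to X'$ implies $\mathsf{Lm}\,y\,X\to\mathsf{Lm}\,y\,X'$; $\twoheadrightarrow$ is its reflexive-transitive closure. $\mathsf{enc}:\mathbf{term}\to\mathbf{term}'$ is the unique function with $\mathsf{enc}\,(\mathsf{Var}\,x)=\mathsf{Var}\,x$, $\mathsf{enc}\,(\mathsf{Ct}\,c)=\mathsf{Ct}\,c$, $\mathsf{enc}\,(\mathsf{App}\,X\,Y)=\mathsf{App}\,(\mathsf{App}\,\mathsf{ctapp}\,(\mathsf{enc}\,X))\,(\mathsf{enc}\,Y)$, $\mathsf{enc}\,(\mathsf{Lm}\,x\,X)=\mathsf{App}\,\mathsf{ctlm}\,(\mathsf{Lm}\,x\,(\mathsf{enc}\,X))$. -}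

module Defs where

open import Data.Nat using (ℕ; zero; suc)
open import Data.Fin using (Fin; zero; suc)
open import Data.Maybe using (Maybe; just)
open import Relation.Binary.PropositionalEquality using (_≡_)
open import Relation.Binary.Construct.Closure.ReflexiveTransitive using (Star)

-- λ-terms up to α-equivalence, represented as well-scoped de Bruijn terms:
-- free variables are named (from V), bound variables are de Bruijn indices
-- (Fin n, n = number of enclosing binders).  Tm V K 0 is exactly the type of
-- α-equivalence classes of named λ-terms with variables in V, constants in K.
data Tm (V K : Set) (n : ℕ) : Set where
  Var  : V → Tm V K n
  BVar : Fin n → Tm V K n
  Ct   : K → Tm V K n
  App  : Tm V K n → Tm V K n → Tm V K n
  Lm   : Tm V K (suc n) → Tm V K n

module _ {V K : Set} where

  ext : ∀ {n m} → (Fin n → Fin m) → Fin (suc n) → Fin (suc m)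
  ext ρ zero    = zero
  ext ρ (suc i) = suc (ρ i)

  rename : ∀ {n m} → (Fin n → Fin m) → Tm V K n → Tm V K m
  rename ρ (Var x)   = Var x
  rename ρ (BVar i)  = BVar (ρ i)
  rename ρ (Ct c)    = Ct c
  rename ρ (App X Y) = App (rename ρ X) (rename ρ Y)
  rename ρ (Lm X)    = Lm (rename (ext ρ) X)

  exts : ∀ {n m} → (Fin n → Tm V K m) → Fin (suc n) → Tm V K (suc m)
  exts σ zero    = BVar zero
  exts σ (suc i) = rename suc (σ i)

  subst : ∀ {n m} → (Fin n → Tm V K m) → Tm V K n → Tm V K m
  subst σ (Var x)   = Var x
  subst σ (BVar i)  = σ i
  subst σ (Ct c)    = Ct c
  subst σ (App X Y) = App (subst σ X) (subst σ Y)
  subst σ (Lm X)    = Lm (subst (exts σ) X)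

  inst : ∀ {n} → Tm V K (suc n) → Tm V K n → Tm V K n
  inst {n} X Y = subst σ X
    where
      σ : Fin (suc n) → Tm V K n
      σ zero    = Y
      σ (suc i) = BVar i

  weaken : ∀ {n} → Tm V K 0 → Tm V K n
  weaken = rename (λ ())

mapCt : ∀ {V K L n} → (K → L) → Tm V K n → Tm V L n
mapCt f (Var x)   = Var x
mapCt f (BVar i)  = BVar i
mapCt f (Ct c)    = Ct (f c)
mapCt f (App X Y) = App (mapCt f X) (mapCt f Y)
mapCt f (Lm X)    = Lm (mapCt f X)

data Const' (C : Set) : Set where
  old   : C → Const' C
  ctapp : Const' C
  ctlm  : Const' C

-- term' ; term ⊆ term' via the inclusion of constants
Term' : Set → Set → ℕ → Set
Term' V C n = Tm V (Const' C) n

incl : ∀ {V C n} → Tm V C n → Term' V C n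
incl = mapCt old

data _⊢_⟶_ {V C : Set} (Ctapp : C → C → Maybe (Tm V C 0)) {n : ℕ}
     : Term' V C n → Term' V C n → Set where
  β    : ∀ X Y → Ctapp ⊢ App (Lm X) Y ⟶ inst X Y
  δ    : ∀ c₁ c₂ X → Ctapp c₁ c₂ ≡ just X →
         Ctapp ⊢ App (Ct (old c₁)) (Ct (old c₂)) ⟶ weaken (incl X)
  AppL : ∀ {X X'} Y → Ctapp ⊢ X ⟶ X' → Ctapp ⊢ App X Y ⟶ App X' Y
  AppR : ∀ X {Y Y'} → Ctapp ⊢ Y ⟶ Y' → Ctapp ⊢ App X Y ⟶ App X Y'
  ξ    : ∀ {X X'} → _⊢_⟶_ Ctapp X X' → Ctapp ⊢ Lm X ⟶ Lm X'

_⊢_⟶*_ : ∀ {V C : Set} → (C → C → Maybe (Tm V C 0)) → ∀ {n} →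
         Term' V C n → Term' V C n → Set
Ctapp ⊢ X ⟶* Y = Star (Ctapp ⊢_⟶_) X Y

enc : ∀ {V C n} → Tm V C n → Term' V C n
enc (Var x)   = Var x
enc (BVar i)  = BVar i
enc (Ct c)    = Ct (old c)
enc (App X Y) = App (App (Ct ctapp) (enc X)) (enc Y)
enc (Lm X)    = App (Ct ctlm) (Lm (enc X))

{-# OPTIONS --safe #-}
module Submission where

open import Defs
open import Data.Nat using (ℕ)
open import Data.Maybe using (Maybe)
open import Function.Bundles using (_↣_)
open import Relation.Nullary using (¬_)
open import Relation.Binary.PropositionalEquality using (_≡_; refl)
open import Relation.Binary.Construct.Closure.ReflexiveTransitive using (ε; _◅_)

-- Every redex needs an abstraction or a constant of `const` in head position
-- of an application; in `enc X` each application is headed by `ctapp` or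
-- `ctlm`, so there is none.

module _ {V C : Set} (Ctapp : C → C → Maybe (Tm V C 0)) where

  Normal : ∀ {n} → Term' V C n → Set
  Normal X = ∀ {Y} → ¬ (Ctapp ⊢ X ⟶ Y)

  normal⇒⟶*-fixed : ∀ {n} {X Y : Term' V C n} → Normal X → Ctapp ⊢ X ⟶* Y → Y ≡ X
  normal⇒⟶*-fixed X-nf ε         = refl
  normal⇒⟶*-fixed X-nf (step ◅ _) with () ← X-nf step

  Ct-normal : ∀ {n} (k : Const' C) → Normal {n} (Ct k)
  Ct-normal k ()

  enc-normal : ∀ {n} (X : Tm V C n) → Normal (enc X)
  enc-normal (App X Y) (AppL _ (AppL _ step)) = Ct-normal ctapp step
  enc-normal (App X Y) (AppL _ (AppR _ step)) = enc-normal X step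
  enc-normal (App X Y) (AppR _ step)          = enc-normal Y step
  enc-normal (Lm X)    (AppL _ step)          = Ct-normal ctlm step
  enc-normal (Lm X)    (AppR _ (ξ step))      = enc-normal X step

lemma8 : (V C : Set) → (ℕ ↣ V) → (Ctapp : C → C → Maybe (Tm V C 0)) →
         (X : Tm V C 0) (Y : Term' V C 0) →
         Ctapp ⊢ enc X ⟶* Y → Y ≡ enc X
lemma8 V C _ Ctapp X Y = normal⇒⟶*-fixed Ctapp (enc-normal Ctapp X)
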